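{- For all finite multisets $\Gamma,\Delta$ of formulas: $\Gamma\Rightarrow\Delta$ is derivable in $\mathsf{GWF\widehat{D}}$ if and only if $\vdash_{\mathsf{WF\widehat{D}}}\bigwedge\Gamma\rightarrow\bigvee\Delta$.
   Context: Formulas are built from a countable set of propositional atoms and $\bot$ using $\wedge,\vee,\rightarrow$; $A\leftrightarrow B$ abbreviates $(A\rightarrow B)\wedge(B\rightarrow A)$. $\bigwedge\Gamma$, $\bigvee\Delta$ are the conjunction/disjunction of the formulas of the multiset (empty conjunction read as $\bot\rightarrow\bot$, empty disjunction as $\bot$). Sequent calculus $\mathsf{GWF\widehat{D}}$ (sequents $\Gamma\Rightarrow\Delta$, finite multisets, $p$ atomic): (Ax) $p,\Gamma\Rightarrow\Delta,p$; ($\bot_L$) $\bot,\Gamma\Rightarrow\Delta$; ($\wedge_L$) from $A,B,\Gamma\Rightarrow\Delta$ infer $A\wedge B,\Gamma\Rightarrow\Delta$; ($\wedge_R$) from $\Gamma\Rightarrow\Delta,A$ and $\Gamma\Rightarrow\Delta,B$ infer $\Gamma\Rightarrow\Delta,A\wedge B$; ($\vee_L$) from $A,\Gamma\Rightarrow\Delta$ and $B,\Gamma\Rightarrow\Delta$ infer $A\vee B,\Gamma\Rightarrow\Delta$; ($\vee_R$) from $\Gamma\Rightarrow\Delta,A,B$ infer $\Gamma\Rightarrow\Delta,A\vee B$; ($\rightarrow_R$) from $A\Rightarrow B$ infer $\Gamma\Rightarrow A\rightarrow B,\Delta$; ($\rightarrow_{LR}$) from $A\Rightarrow B$, $B\Rightarrow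 A$, $C\Rightarrow D$, $D\Rightarrow C$ infer $\Gamma,A\rightarrow C\Rightarrow B\rightarrow D,\Delta$; (Cut) from $\Gamma\Rightarrow D,\Delta$ and $D,\Gamma'\Rightarrow\Delta'$ infer $\Gamma,\Gamma'\Rightarrow\Delta,\Delta'$; ($\rightarrow_{\widehat{D}}$) from $A\Rightarrow B$ infer $\Gamma,B\rightarrow C\Rightarrow A\rightarrow C,\Delta$. Hilbert system $\mathsf{WF}$: axioms all instances of $A\rightarrow(A\vee B)$; $B\rightarrow(A\vee B)$; $(A\wedge B)\rightarrow A$; $(A\wedge B)\rightarrow B$; $A\wedge(B\vee C)\rightarrow(A\wedge B)\vee(A\wedge C)$; $A\rightarrow A$; $\bot\rightarrow A$; rules: from $A$, $A\rightarrow B$ infer $B$; from $A$ infer $B\rightarrow A$; from $A\rightarrow B$, $B\rightarrow C$ infer $A\rightarrow C$; from $A\rightarrow B$, $A\rightarrow C$ infer $A\rightarrow(B\wedge C)$; from $A\rightarrow C$, $B\rightarrow C$ infer $(A\vee B)\rightarrow C$; from $A$, $B$ infer $A\wedge B$; from $A\leftrightarrow B$, $C\leftrightarrow D$ infer $(A\rightarrow C)\leftrightarrow(B\rightarrow D)$. $\mathsf{WF\widehat{D}}$ is $\mathsf{WF}$ plus all instances of the axiom $(A\vee B\rightarrow C)\rightarrow(A\rightarrow C)\wedge(B\rightarrow C)$. -}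

module Defs where

open import Data.Nat using (ℕ)
open import Data.List using (List; []; _∷_; _++_)
open import Data.List.Relation.Binary.Permutation.Propositional using (_↭_)

infixr 6 _∧_
infixr 5 _∨_
infixr 4 _⇒_

data Fml : Set where
  atom : ℕ → Fml
  ⊥'   : Fml
  _∧_  : Fml → Fml → Fml
  _∨_  : Fml → Fml → Fml
  _⇒_  : Fml → Fml → Fml

_⇔_ : Fml → Fml → Fml
A ⇔ B = (A ⇒ B) ∧ (B ⇒ A)

⋀ : List Fml → Fml
⋀ []           = ⊥' ⇒ ⊥'
⋀ (A ∷ [])     = A
⋀ (A ∷ B ∷ Γ)  = A ∧ ⋀ (B ∷ Γ)

⋁ : List Fml → Fml
⋁ []           = ⊥'
⋁ (A ∷ [])     = A
⋁ (A ∷ B ∷ Δ)  = A ∨ ⋁ (B ∷ Δ)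

-- Sequent calculus GWF^D. Multisets are lists; the rule `exch` closes
-- derivability under permutation of either side, so derivability is a
-- relation on multisets.
infix 3 _⊢G_
data _⊢G_ : List Fml → List Fml → Set where
  exch  : ∀ {Γ Γ' Δ Δ'} → Γ ↭ Γ' → Δ ↭ Δ' → Γ ⊢G Δ → Γ' ⊢G Δ'
  ax    : ∀ {p Γ Δ} → (atom p ∷ Γ) ⊢G (atom p ∷ Δ)
  ⊥L    : ∀ {Γ Δ} → (⊥' ∷ Γ) ⊢G Δ
  ∧L    : ∀ {A B Γ Δ} → (A ∷ B ∷ Γ) ⊢G Δ → ((A ∧ B) ∷ Γ) ⊢G Δ
  ∧R    : ∀ {A B Γ Δ} → Γ ⊢G (A ∷ Δ) → Γ ⊢G (B ∷ Δ) → Γ ⊢G ((A ∧ B) ∷ Δ)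
  ∨L    : ∀ {A B Γ Δ} → (A ∷ Γ) ⊢G Δ → (B ∷ Γ) ⊢G Δ → ((A ∨ B) ∷ Γ) ⊢G Δ
  ∨R    : ∀ {A B Γ Δ} → Γ ⊢G (A ∷ B ∷ Δ) → Γ ⊢G ((A ∨ B) ∷ Δ)
  ⇒R    : ∀ {A B Γ Δ} → (A ∷ []) ⊢G (B ∷ []) → Γ ⊢G ((A ⇒ B) ∷ Δ)
  ⇒LR   : ∀ {A B C D Γ Δ} →
          (A ∷ []) ⊢G (B ∷ []) → (B ∷ []) ⊢G (A ∷ []) →
          (C ∷ []) ⊢G (D ∷ []) → (D ∷ []) ⊢G (C ∷ []) →
          ((A ⇒ C) ∷ Γ) ⊢G ((B ⇒ D) ∷ Δ)
  cut   : ∀ {D Γ Γ' Δ Δ'} → Γ ⊢G (D ∷ Δ) → (D ∷ Γ') ⊢G Δ' →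
          (Γ ++ Γ') ⊢G (Δ ++ Δ')
  ⇒D    : ∀ {A B C Γ Δ} → (A ∷ []) ⊢G (B ∷ []) →
          ((B ⇒ C) ∷ Γ) ⊢G ((A ⇒ C) ∷ Δ)

infix 3 ⊢WFD_
data ⊢WFD_ : Fml → Set where
  ∨I₁   : ∀ {A B} → ⊢WFD A ⇒ A ∨ B
  ∨I₂   : ∀ {A B} → ⊢WFD B ⇒ A ∨ B
  ∧E₁   : ∀ {A B} → ⊢WFD A ∧ B ⇒ A
  ∧E₂   : ∀ {A B} → ⊢WFD A ∧ B ⇒ B
  dist  : ∀ {A B C} → ⊢WFD A ∧ (B ∨ C) ⇒ (A ∧ B) ∨ (A ∧ C)
  idA   : ∀ {A} → ⊢WFD A ⇒ A
  efq   : ∀ {A} → ⊢WFD ⊥' ⇒ A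
  axD   : ∀ {A B C} → ⊢WFD (A ∨ B ⇒ C) ⇒ (A ⇒ C) ∧ (B ⇒ C)
  mp    : ∀ {A B} → ⊢WFD A → ⊢WFD A ⇒ B → ⊢WFD B
  wk    : ∀ {A B} → ⊢WFD A → ⊢WFD B ⇒ A
  trans : ∀ {A B C} → ⊢WFD A ⇒ B → ⊢WFD B ⇒ C → ⊢WFD A ⇒ C
  ∧Rr   : ∀ {A B C} → ⊢WFD A ⇒ B → ⊢WFD A ⇒ C → ⊢WFD A ⇒ B ∧ C
  ∨Lr   : ∀ {A B C} → ⊢WFD A ⇒ C → ⊢WFD B ⇒ C → ⊢WFD A ∨ B ⇒ C
  ∧I    : ∀ {A B} → ⊢WFD A → ⊢WFD B → ⊢WFD A ∧ B
  cong⇒ : ∀ {A B C D} → ⊢WFD A ⇔ B → ⊢WFD C ⇔ D →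
          ⊢WFD (A ⇒ C) ⇔ (B ⇒ D)

{-# OPTIONS --safe #-}
-- Completeness: every axiom and rule of WF^D is admissible for sequents ⇒ F.
-- The rules whose premises are implications (or equivalences) need ⇒ A → B to
-- yield A ⇒ B, i.e. invertibility of →R in the empty context. This comes from
-- an interpretation in which atoms and ⊥ are false and A → B is true iff A ⇒ B
-- is derivable: every rule of GWF^D, cut included, preserves truth (for →LR and
-- →D by cutting with their premises), so a derivable ⇒ F makes F true.
module Submission where

open import Defs
open import Data.List using (List; []; _∷_; _++_)
open import Data.List.Properties using (++-assoc; ++-identityʳ)
open import Data.List.Membership.Propositional using (_∈_)
open import Data.List.Membership.Propositional.Properties using (∈-∃++)
open import Data.List.Relation.Unary.All using (All; []; _∷_)
open import Data.List.Relation.Unary.Any using (Any; here; there)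
open import Data.List.Relation.Binary.Permutation.Propositional
  using (_↭_; refl; prep; swap; trans; ↭-sym; ↭-reflexive)
open import Data.List.Relation.Binary.Permutation.Propositional.Properties
  using (All-resp-↭; Any-resp-↭; ++⁺ʳ; ++-comm; shift)
open import Data.Empty using (⊥)
open import Data.Product using (Σ-syntax; _×_; _,_)
open import Data.Sum using (_⊎_; inj₁; inj₂)
open import Relation.Binary.PropositionalEquality using (refl; sym)
import Data.List.Relation.Unary.All.Properties as All
import Data.List.Relation.Unary.Any.Properties as Any

variable
  A B C D F : Fml
  Γ Γ′ Δ Δ′ : List Fml

infix 3 _⊑_
_⊑_ : Fml → Fml → Set
A ⊑ B = ⊢WFD A ⇒ B

infixr 9 _⨾_
_⨾_ : A ⊑ B → B ⊑ C → A ⊑ C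
_⨾_ = trans

⊑-⋀[] : A ⊑ ⋀ []
⊑-⋀[] = wk idA

∧-mono : A ⊑ B → C ⊑ D → A ∧ C ⊑ B ∧ D
∧-mono f g = ∧Rr (∧E₁ ⨾ f) (∧E₂ ⨾ g)

∨-mono : A ⊑ B → C ⊑ D → A ∨ C ⊑ B ∨ D
∨-mono f g = ∨Lr (f ⨾ ∨I₁) (g ⨾ ∨I₂)

∧-comm : A ∧ B ⊑ B ∧ A
∧-comm = ∧Rr ∧E₂ ∧E₁

∧-assocˡ : A ∧ (B ∧ C) ⊑ (A ∧ B) ∧ C
∧-assocˡ = ∧Rr (∧Rr ∧E₁ (∧E₂ ⨾ ∧E₁)) (∧E₂ ⨾ ∧E₂)

∧-assocʳ : (A ∧ B) ∧ C ⊑ A ∧ (B ∧ C)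
∧-assocʳ = ∧Rr (∧E₁ ⨾ ∧E₁) (∧Rr (∧E₁ ⨾ ∧E₂) ∧E₂)

∨-assocˡ : A ∨ (B ∨ C) ⊑ (A ∨ B) ∨ C
∨-assocˡ = ∨Lr (∨I₁ ⨾ ∨I₁) (∨Lr (∨I₂ ⨾ ∨I₁) ∨I₂)

∨-assocʳ : (A ∨ B) ∨ C ⊑ A ∨ (B ∨ C)
∨-assocʳ = ∨Lr (∨Lr ∨I₁ (∨I₁ ⨾ ∨I₂)) (∨I₂ ⨾ ∨I₂)

∧-swap : A ∧ (B ∧ C) ⊑ B ∧ (A ∧ C)
∧-swap = ∧Rr (∧E₂ ⨾ ∧E₁) (∧Rr ∧E₁ (∧E₂ ⨾ ∧E₂))

∨-swap : A ∨ (B ∨ C) ⊑ B ∨ (A ∨ C)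
∨-swap = ∨Lr (∨I₁ ⨾ ∨I₂) (∨Lr ∨I₁ (∨I₂ ⨾ ∨I₂))

∧-distribʳ-∨ : (A ∨ B) ∧ C ⊑ (A ∧ C) ∨ (B ∧ C)
∧-distribʳ-∨ = ∧-comm ⨾ dist ⨾ ∨-mono ∧-comm ∧-comm

∨-distribʳ-∧⁻¹ : (A ∨ C) ∧ (B ∨ C) ⊑ (A ∧ B) ∨ C
∨-distribʳ-∧⁻¹ =
  ∧-distribʳ-∨ ⨾ ∨Lr (dist ⨾ ∨Lr ∨I₁ (∧E₂ ⨾ ∨I₂)) (∧E₁ ⨾ ∨I₂)

⇔⇒⊑ : ⊢WFD A ⇔ B → A ⊑ B
⇔⇒⊑ A⇔B = mp A⇔B ∧E₁

⇔⇒⊒ : ⊢WFD A ⇔ B → B ⊑ A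
⇔⇒⊒ A⇔B = mp A⇔B ∧E₂

⇒-cong : A ⊑ B → B ⊑ A → C ⊑ D → D ⊑ C → A ⇒ C ⊑ B ⇒ D
⇒-cong f f⁻¹ g g⁻¹ = ⇔⇒⊑ (cong⇒ (∧I f f⁻¹) (∧I g g⁻¹))

-- A ⊑ B makes A ∨ B equivalent to B, so B → C is equivalent to A ∨ B → C,
-- which yields A → C by the axiom D^.
⇒-antitone : A ⊑ B → B ⇒ C ⊑ A ⇒ C
⇒-antitone {A} {B} A⊑B =
  ⇔⇒⊒ (cong⇒ A∨B⇔B (∧I idA idA)) ⨾ axD ⨾ ∧E₁
  where
  A∨B⇔B : ⊢WFD (A ∨ B) ⇔ B
  A∨B⇔B = ∧I (∨Lr A⊑B idA) ∨I₂

⋀-uncons : ∀ A Γ → ⋀ (A ∷ Γ) ⊑ A ∧ ⋀ Γ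
⋀-uncons A []      = ∧Rr idA ⊑-⋀[]
⋀-uncons A (_ ∷ _) = idA

⋀-cons : ∀ A Γ → A ∧ ⋀ Γ ⊑ ⋀ (A ∷ Γ)
⋀-cons A []      = ∧E₁
⋀-cons A (_ ∷ _) = idA

⋁-uncons : ∀ A Δ → ⋁ (A ∷ Δ) ⊑ A ∨ ⋁ Δ
⋁-uncons A []      = ∨I₁
⋁-uncons A (_ ∷ _) = idA

⋁-cons : ∀ A Δ → A ∨ ⋁ Δ ⊑ ⋁ (A ∷ Δ)
⋁-cons A []      = ∨Lr idA efq
⋁-cons A (_ ∷ _) = idA

⋀-head : ∀ Γ → ⋀ (A ∷ Γ) ⊑ A
⋀-head Γ = ⋀-uncons _ Γ ⨾ ∧E₁

⋁-head : ∀ Δ → A ⊑ ⋁ (A ∷ Δ)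
⋁-head Δ = ∨I₁ ⨾ ⋁-cons _ Δ

⋀-++ : ∀ Γ Γ′ → ⋀ (Γ ++ Γ′) ⊑ ⋀ Γ ∧ ⋀ Γ′
⋀-++ []      Γ′ = ∧Rr ⊑-⋀[] idA
⋀-++ (A ∷ Γ) Γ′ =
  ⋀-uncons A (Γ ++ Γ′) ⨾ ∧-mono idA (⋀-++ Γ Γ′) ⨾ ∧-assocˡ ⨾ ∧-mono (⋀-cons A Γ) idA

⋁-++ : ∀ Δ Δ′ → ⋁ Δ ∨ ⋁ Δ′ ⊑ ⋁ (Δ ++ Δ′)
⋁-++ []      Δ′ = ∨Lr efq idA
⋁-++ (A ∷ Δ) Δ′ =
  ∨-mono (⋁-uncons A Δ) idA ⨾ ∨-assocʳ ⨾ ∨-mono idA (⋁-++ Δ Δ′) ⨾ ⋁-cons A (Δ ++ Δ′)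

⋀-resp-↭ : Γ ↭ Γ′ → ⋀ Γ ⊑ ⋀ Γ′
⋀-resp-↭ refl = idA
⋀-resp-↭ (prep {xs} {ys} x p) =
  ⋀-uncons x xs ⨾ ∧-mono idA (⋀-resp-↭ p) ⨾ ⋀-cons x ys
⋀-resp-↭ (swap {xs} {ys} x y p) =
  ⋀-uncons x (y ∷ xs) ⨾ ∧-mono idA (⋀-uncons y xs) ⨾ ∧-swap ⨾
  ∧-mono idA (∧-mono idA (⋀-resp-↭ p) ⨾ ⋀-cons x ys) ⨾ ⋀-cons y (x ∷ ys)
⋀-resp-↭ (trans p q) = ⋀-resp-↭ p ⨾ ⋀-resp-↭ q

⋁-resp-↭ : Δ ↭ Δ′ → ⋁ Δ ⊑ ⋁ Δ′
⋁-resp-↭ refl = idA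
⋁-resp-↭ (prep {xs} {ys} x p) =
  ⋁-uncons x xs ⨾ ∨-mono idA (⋁-resp-↭ p) ⨾ ⋁-cons x ys
⋁-resp-↭ (swap {xs} {ys} x y p) =
  ⋁-uncons x (y ∷ xs) ⨾ ∨-mono idA (⋁-uncons y xs) ⨾ ∨-swap ⨾
  ∨-mono idA (∨-mono idA (⋁-resp-↭ p) ⨾ ⋁-cons x ys) ⨾ ⋁-cons y (x ∷ ys)
⋁-resp-↭ (trans p q) = ⋁-resp-↭ p ⨾ ⋁-resp-↭ q

⊢G⇒⊢WFD : Γ ⊢G Δ → ⋀ Γ ⊑ ⋁ Δ
⊢G⇒⊢WFD (exch p q d) = ⋀-resp-↭ (↭-sym p) ⨾ ⊢G⇒⊢WFD d ⨾ ⋁-resp-↭ q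
⊢G⇒⊢WFD (ax {Γ = Γ} {Δ}) = ⋀-head Γ ⨾ ⋁-head Δ
⊢G⇒⊢WFD (⊥L {Γ}) = ⋀-head Γ ⨾ efq
⊢G⇒⊢WFD (∧L {A} {B} {Γ} d) =
  ⋀-uncons _ Γ ⨾ ∧-assocʳ ⨾ ∧-mono idA (⋀-cons B Γ) ⨾ ⊢G⇒⊢WFD d
⊢G⇒⊢WFD (∧R {A} {B} {Δ = Δ} d e) =
  ∧Rr (⊢G⇒⊢WFD d ⨾ ⋁-uncons A Δ) (⊢G⇒⊢WFD e ⨾ ⋁-uncons B Δ) ⨾
  ∨-distribʳ-∧⁻¹ ⨾ ⋁-cons _ Δ
⊢G⇒⊢WFD (∨L {A} {B} {Γ} d e) =
  ⋀-uncons _ Γ ⨾ ∧-distribʳ-∨ ⨾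
  ∨Lr (⋀-cons A Γ ⨾ ⊢G⇒⊢WFD d) (⋀-cons B Γ ⨾ ⊢G⇒⊢WFD e)
⊢G⇒⊢WFD (∨R {A} {B} {Δ = Δ} d) =
  ⊢G⇒⊢WFD d ⨾ ⋁-uncons A (B ∷ Δ) ⨾ ∨-mono idA (⋁-uncons B Δ) ⨾ ∨-assocˡ ⨾
  ⋁-cons _ Δ
⊢G⇒⊢WFD (⇒R {Δ = Δ} d) = wk (⊢G⇒⊢WFD d) ⨾ ⋁-head Δ
⊢G⇒⊢WFD (⇒LR {Γ = Γ} {Δ} d₁ d₂ d₃ d₄) =
  ⋀-head Γ ⨾
  ⇒-cong (⊢G⇒⊢WFD d₁) (⊢G⇒⊢WFD d₂) (⊢G⇒⊢WFD d₃) (⊢G⇒⊢WFD d₄) ⨾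
  ⋁-head Δ
⊢G⇒⊢WFD (cut {D} {Γ} {Γ′} {Δ} {Δ′} d e) =
  ⋀-++ Γ Γ′ ⨾ ∧-mono (⊢G⇒⊢WFD d ⨾ ⋁-uncons D Δ) idA ⨾ ∧-distribʳ-∨ ⨾
  ∨Lr (⋀-cons D Γ′ ⨾ ⊢G⇒⊢WFD e ⨾ ∨I₂) (∧E₁ ⨾ ∨I₁) ⨾ ⋁-++ Δ Δ′
⊢G⇒⊢WFD (⇒D {Γ = Γ} {Δ} d) =
  ⋀-head Γ ⨾ ⇒-antitone (⊢G⇒⊢WFD d) ⨾ ⋁-head Δ

⟦_⟧ : Fml → Set
⟦ atom _ ⟧ = ⊥
⟦ ⊥' ⟧     = ⊥
⟦ A ∧ B ⟧  = ⟦ A ⟧ × ⟦ B ⟧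
⟦ A ∨ B ⟧  = ⟦ A ⟧ ⊎ ⟦ B ⟧
⟦ A ⇒ B ⟧  = A ∷ [] ⊢G B ∷ []

⊢G-sound : Γ ⊢G Δ → All ⟦_⟧ Γ → Any ⟦_⟧ Δ
⊢G-sound (exch p q d) γ = Any-resp-↭ q (⊢G-sound d (All-resp-↭ (↭-sym p) γ))
⊢G-sound ax (() ∷ _)
⊢G-sound ⊥L (() ∷ _)
⊢G-sound (∧L d) ((a , b) ∷ γ) = ⊢G-sound d (a ∷ b ∷ γ)
⊢G-sound (∧R d e) γ with ⊢G-sound d γ | ⊢G-sound e γ
... | here a  | here b  = here (a , b)
... | there δ | _       = there δ
... | here _  | there δ = there δ
⊢G-sound (∨L d e) (inj₁ a ∷ γ) = ⊢G-sound d (a ∷ γ)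
⊢G-sound (∨L d e) (inj₂ b ∷ γ) = ⊢G-sound e (b ∷ γ)
⊢G-sound (∨R d) γ with ⊢G-sound d γ
... | here a          = here (inj₁ a)
... | there (here b)  = here (inj₂ b)
... | there (there δ) = there δ
⊢G-sound (⇒R d) γ = here d
⊢G-sound (⇒LR A⊢B B⊢A C⊢D D⊢C) (A⊢C ∷ _) = here (cut B⊢A (cut A⊢C C⊢D))
⊢G-sound (⇒D A⊢B) (B⊢C ∷ _) = here (cut A⊢B B⊢C)
⊢G-sound (cut {Γ = Γ} {Δ = Δ} d e) γ with All.++⁻ Γ γ
... | γ₁ , γ₂ with ⊢G-sound d γ₁
...   | here t  = Any.++⁺ʳ Δ (⊢G-sound e (t ∷ γ₂))
...   | there δ = Any.++⁺ˡ δ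

⊢G-closed-true : [] ⊢G F ∷ [] → ⟦ F ⟧
⊢G-closed-true d = Any.singleton⁻ (⊢G-sound d [])

⇒R⁻¹ : [] ⊢G (A ⇒ B) ∷ [] → A ∷ [] ⊢G B ∷ []
⇒R⁻¹ = ⊢G-closed-true

weaken : ∀ Σ Π → Γ ⊢G Δ → Γ ++ Σ ⊢G Δ ++ Π
weaken Σ Π (exch p q d) = exch (++⁺ʳ Σ p) (++⁺ʳ Π q) (weaken Σ Π d)
weaken Σ Π ax = ax
weaken Σ Π ⊥L = ⊥L
weaken Σ Π (∧L d) = ∧L (weaken Σ Π d)
weaken Σ Π (∧R d e) = ∧R (weaken Σ Π d) (weaken Σ Π e)
weaken Σ Π (∨L d e) = ∨L (weaken Σ Π d) (weaken Σ Π e)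
weaken Σ Π (∨R d) = ∨R (weaken Σ Π d)
weaken Σ Π (⇒R d) = ⇒R d
weaken Σ Π (⇒LR d₁ d₂ d₃ d₄) = ⇒LR d₁ d₂ d₃ d₄
weaken Σ Π (⇒D d) = ⇒D d
weaken Σ Π (cut {Γ = Γ} {Γ′} {Δ} {Δ′} d e) =
  exch (↭-reflexive (sym (++-assoc Γ Γ′ Σ))) (↭-reflexive (sym (++-assoc Δ Δ′ Π)))
       (cut d (weaken Σ Π e))

weakenˡ : Γ ⊢G Δ → A ∷ Γ ⊢G Δ
weakenˡ {Γ} {Δ} {A} d =
  exch (++-comm Γ (A ∷ [])) (↭-reflexive (++-identityʳ Δ)) (weaken (A ∷ []) [] d)

weakenʳ : Γ ⊢G Δ → Γ ⊢G A ∷ Δ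
weakenʳ {Γ} {Δ} {A} d =
  exch (↭-reflexive (++-identityʳ Γ)) (++-comm Δ (A ∷ [])) (weaken [] (A ∷ []) d)

identity : ∀ A → A ∷ [] ⊢G A ∷ []
identity (atom _) = ax
identity ⊥'       = ⊥L
identity (A ∧ B)  = ∧L (∧R (weaken (B ∷ []) [] (identity A)) (weakenˡ (identity B)))
identity (A ∨ B)  = ∨R (∨L (weaken [] (B ∷ []) (identity A)) (weakenʳ (identity B)))
identity (A ⇒ B)  = ⇒LR (identity A) (identity A) (identity B) (identity B)

∈⇒↭∷ : A ∈ Γ → Σ[ Γ₀ ∈ List Fml ] Γ ↭ A ∷ Γ₀
∈⇒↭∷ {A} A∈Γ with Γ₁ , Γ₂ , refl ← ∈-∃++ A∈Γ = Γ₁ ++ Γ₂ , shift A Γ₁ Γ₂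

init : A ∈ Γ → A ∈ Δ → Γ ⊢G Δ
init {A} A∈Γ A∈Δ with Γ₀ , Γ↭ ← ∈⇒↭∷ A∈Γ | Δ₀ , Δ↭ ← ∈⇒↭∷ A∈Δ =
  exch (↭-sym Γ↭) (↭-sym Δ↭) (weaken Γ₀ Δ₀ (identity A))

⊢⋀ : ∀ Γ → Γ ⊢G ⋀ Γ ∷ []
⊢⋀ []          = ⇒R ⊥L
⊢⋀ (A ∷ [])    = identity A
⊢⋀ (A ∷ B ∷ Γ) = ∧R (init (here refl) (here refl)) (weakenˡ (⊢⋀ (B ∷ Γ)))

⋁⊢ : ∀ Δ → ⋁ Δ ∷ [] ⊢G Δ
⋁⊢ []          = ⊥L
⋁⊢ (A ∷ [])    = identity A
⋁⊢ (A ∷ B ∷ Δ) = ∨L (init (here refl) (here refl)) (weakenʳ (⋁⊢ (B ∷ Δ)))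

⊢WFD⇒⊢G : ⊢WFD F → [] ⊢G F ∷ []
⊢WFD⇒⊢G ∨I₁  = ⇒R (∨R (init (here refl) (here refl)))
⊢WFD⇒⊢G ∨I₂  = ⇒R (∨R (init (here refl) (there (here refl))))
⊢WFD⇒⊢G ∧E₁  = ⇒R (∧L (init (here refl) (here refl)))
⊢WFD⇒⊢G ∧E₂  = ⇒R (∧L (init (there (here refl)) (here refl)))
⊢WFD⇒⊢G (dist {A} {B} {C}) =
  ⇒R (∧L (exch (swap (B ∨ C) A refl) refl (∨L
    (∨R (∧R (init (there (here refl)) (here refl)) (init (here refl) (here refl))))
    (∨R (exch refl (swap (A ∧ C) (A ∧ B) refl)
      (∧R (init (there (here refl)) (here refl)) (init (here refl) (here refl))))))))
⊢WFD⇒⊢G idA  = ⇒R (identity _)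
⊢WFD⇒⊢G efq  = ⇒R ⊥L
⊢WFD⇒⊢G axD  =
  ⇒R (∧R (⇒D (∨R (init (here refl) (here refl))))
         (⇒D (∨R (init (here refl) (there (here refl))))))
⊢WFD⇒⊢G (mp d e)    = cut (⊢WFD⇒⊢G d) (⇒R⁻¹ (⊢WFD⇒⊢G e))
⊢WFD⇒⊢G (wk d)      = ⇒R (weakenˡ (⊢WFD⇒⊢G d))
⊢WFD⇒⊢G (trans d e) = ⇒R (cut (⇒R⁻¹ (⊢WFD⇒⊢G d)) (⇒R⁻¹ (⊢WFD⇒⊢G e)))
⊢WFD⇒⊢G (∧Rr d e)   = ⇒R (∧R (⇒R⁻¹ (⊢WFD⇒⊢G d)) (⇒R⁻¹ (⊢WFD⇒⊢G e)))
⊢WFD⇒⊢G (∨Lr d e)   = ⇒R (∨L (⇒R⁻¹ (⊢WFD⇒⊢G d)) (⇒R⁻¹ (⊢WFD⇒⊢G e)))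
⊢WFD⇒⊢G (∧I d e)    = ∧R (⊢WFD⇒⊢G d) (⊢WFD⇒⊢G e)
⊢WFD⇒⊢G (cong⇒ d e) =
  let A⊢B , B⊢A = ⊢G-closed-true (⊢WFD⇒⊢G d)
      C⊢D , D⊢C = ⊢G-closed-true (⊢WFD⇒⊢G e)
  in ∧R (⇒R (⇒LR A⊢B B⊢A C⊢D D⊢C)) (⇒R (⇒LR B⊢A A⊢B D⊢C C⊢D))

mainTheorem9 : (Γ Δ : List Fml) →
    ((Γ ⊢G Δ) → (⊢WFD (⋀ Γ ⇒ ⋁ Δ))) × ((⊢WFD (⋀ Γ ⇒ ⋁ Δ)) → (Γ ⊢G Δ))
mainTheorem9 Γ Δ = ⊢G⇒⊢WFD , complete
  where
  complete : ⋀ Γ ⊑ ⋁ Δ → Γ ⊢G Δ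
  complete ⋀Γ⊑⋁Δ =
    exch (↭-reflexive (++-identityʳ Γ)) refl
      (cut (⊢⋀ Γ) (cut (⇒R⁻¹ (⊢WFD⇒⊢G ⋀Γ⊑⋁Δ)) (⋁⊢ Δ)))
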